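{- Let $G=(V,E)$ be a finite undirected graph and $k$ a positive integer with $|V|\ge k$. Let $G'$ be the graph obtained from $G$ by adding $k$ new vertices $U=\{u_1,\dots,u_k\}$, each adjacent to every vertex of $V$ and to no other vertex of $U$ (so $U$ is an independent set). Let $f(i)=\max(k-i,0)$ for $i\in\mathbb{N}$. Let $\sigma$ be any permutation of $V\cup U$, and let $\sigma'$ be a permutation obtained from $\sigma$ by placing the vertices of $U$ at positions $k+1,\dots,2k$ and the vertices of $V$ at the remaining positions in the same relative order as in $\sigma$. Then $C_{G'}(\sigma')\le C_{G'}(\sigma)$.
   Context: For a graph $H$ and a permutation $\tau=(w_1,\dots,w_N)$ of its vertices, $r(w_t,H,\tau)$ denotes the number of neighbors of $w_t$ in $H$ that appear before $w_t$ in $\tau$, and $C_H(\tau)=\sum_{t=1}^N f(r(w_t,H,\tau))$. -}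

module Defs where

open import Data.Nat using (ℕ; _∸_; _<ᵇ_)
open import Data.Bool using (Bool; true; false; _∧_; if_then_else_)
open import Data.Fin using (Fin; toℕ; splitAt; _↑ˡ_; _↑ʳ_)
open import Data.Fin.Permutation using (Permutation′; _⟨$⟩ʳ_)
open import Data.List using (List; map)
open import Data.Nat.ListAction using (sum)
open import Data.List using () renaming (allFin to allFinL)
open import Data.Sum using (_⊎_; inj₁; inj₂)
open import Relation.Binary.PropositionalEquality using (_≡_; refl)

record Graph (n : ℕ) : Set where
  field
    adj    : Fin n → Fin n → Bool
    sym    : ∀ u v → adj u v ≡ adj v u
    irrefl : ∀ v → adj v v ≡ false
open Graph public

countFin : ∀ N → (Fin N → Bool) → ℕ
countFin N P = sum (map (λ s → if P s then 1 else 0) (allFinL N))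

-- An ordering τ of the vertices: τ ⟨$⟩ʳ t is the vertex at position t.
-- r(w_t, H, τ): number of neighbours of w_t in H appearing before position t.
r : ∀ {N} → Graph N → Permutation′ N → Fin N → ℕ
r {N} H τ t = countFin N (λ s → (toℕ s <ᵇ toℕ t) ∧ adj H (τ ⟨$⟩ʳ s) (τ ⟨$⟩ʳ t))

C : ∀ {N} → (ℕ → ℕ) → Graph N → Permutation′ N → ℕ
C {N} f H τ = sum (map (λ t → f (r H τ t)) (allFinL N))

-- G' : vertex set Fin (n + k); vertices i ↑ˡ k (i : Fin n) form V, vertices n ↑ʳ j (j : Fin k) form U.
adj' : ∀ {n} k → Graph n → Fin (n Data.Nat.+ k) → Fin (n Data.Nat.+ k) → Bool
adj' {n} k G x y with splitAt n x | splitAt n y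
... | inj₁ a | inj₁ b = adj G a b
... | inj₁ _ | inj₂ _ = true
... | inj₂ _ | inj₁ _ = true
... | inj₂ _ | inj₂ _ = false

adj'-sym : ∀ {n} k (G : Graph n) u v → adj' k G u v ≡ adj' k G v u
adj'-sym {n} k G u v with splitAt n u | splitAt n v
... | inj₁ a | inj₁ b = sym G a b
... | inj₁ _ | inj₂ _ = refl
... | inj₂ _ | inj₁ _ = refl
... | inj₂ _ | inj₂ _ = refl

adj'-irrefl : ∀ {n} k (G : Graph n) v → adj' k G v v ≡ false
adj'-irrefl {n} k G v with splitAt n v
... | inj₁ a = irrefl G a
... | inj₂ _ = refl

extend : ∀ {n} (k : ℕ) → Graph n → Graph (n Data.Nat.+ k)
extend k G = record { adj = adj' k G ; sym = adj'-sym k G ; irrefl = adj'-irrefl k G }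

fk : ℕ → ℕ → ℕ
fk k i = k ∸ i

-- Re-indexing C along the ordering makes it a sum over vertices x of
-- f(number of neighbours of x placed before x).  In G' a V-vertex v has
-- g(v) + a(v) earlier neighbours (g: earlier G-neighbours, a: earlier
-- U-vertices), and a U-vertex u has b(u) earlier neighbours (earlier V-vertices).
--
-- Counting shows that every U-vertex lies in the window
-- [k, 2k) of σ', and that the set S of V-vertices placed before the window has
-- exactly k elements.  So in σ' each U-vertex and each V-vertex after the
-- window has at least k earlier neighbours and costs 0, whence
-- C(σ') ≤ Q := Σ_{v∈S} (k ∸ g(v)); g is the same for σ and σ', which order V alike.
--
-- For v ∈ S, k ∸ g ≤ (k ∸ (g + a)) + a, so
-- Q ≤ Σ_v (k ∸ (g + a)) + Σ_u #{v ∈ S after u}.  S is an initial segment of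
-- the σ-order of V, so if some v ∈ S comes after u then all V-vertices before
-- u are in S; therefore #{v ∈ S after u} ≤ k ∸ b(u), and Q ≤ C(σ).
module Submission where

open import Defs hiding (sym)
open import Data.Nat using (ℕ; zero; suc; _+_; _*_; _∸_; _≤_; _<_; _<ᵇ_; z≤n; s≤s; _≤?_; _<?_)
open import Data.Nat.Properties
open import Data.Bool using (Bool; true; false; _∧_; not; if_then_else_)
open import Data.Bool.Properties using (T-≡; ∧-identityʳ; ∧-zeroʳ) renaming (_≟_ to _≟ᵇ_)
open import Data.Fin using (Fin; zero; suc; toℕ; _↑ˡ_; _↑ʳ_; splitAt)
open import Data.Fin.Properties using (splitAt-↑ˡ; splitAt-↑ʳ; any?)
open import Data.Fin.Permutation using (Permutation′; _⟨$⟩ʳ_; _⟨$⟩ˡ_; flip; inverseʳ)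
open import Data.List using (map; tabulate)
open import Data.Nat.ListAction using () renaming (sum to lsum)
open import Data.Product using (∃; _×_; _,_; proj₁; proj₂)
open import Data.Sum using (_⊎_; inj₁; inj₂)
open import Data.Empty using (⊥-elim)
open import Function using (_∘_; id)
open import Function.Bundles using (_⇔_; Equivalence)
open import Relation.Nullary using (yes; no)
open import Relation.Binary.PropositionalEquality
open import Algebra.Properties.CommutativeMonoid.Sum +-0-commutativeMonoid
  using (sum-permute; ∑-comm; ∑-distrib-+; sum-cong-≗; sum-replicate-zero)
  renaming (sum to Σ)

sum-tabulate : ∀ {A : Set} N (g : Fin N → A) (h : A → ℕ) → lsum (map h (tabulate g)) ≡ Σ (h ∘ g)
sum-tabulate zero    g h = refl
sum-tabulate (suc N) g h = cong (h (g zero) +_) (sum-tabulate N (g ∘ suc) h)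

Σ-mono : ∀ {N} {f g : Fin N → ℕ} → (∀ i → f i ≤ g i) → Σ f ≤ Σ g
Σ-mono {zero}  f≤g = z≤n
Σ-mono {suc N} f≤g = +-mono-≤ (f≤g zero) (Σ-mono (f≤g ∘ suc))

Σ-zero : ∀ {N} (f : Fin N → ℕ) → (∀ i → f i ≡ 0) → Σ f ≡ 0
Σ-zero {N} f f≡0 = trans (sum-cong-≗ f≡0) (sum-replicate-zero N)

Σ-splitAt : ∀ n k (h : Fin (n + k) → ℕ) → Σ h ≡ Σ (λ i → h (i ↑ˡ k)) + Σ (λ j → h (n ↑ʳ j))
Σ-splitAt zero    k h = refl
Σ-splitAt (suc n) k h = trans (cong (h zero +_) (Σ-splitAt n k (h ∘ suc))) (sym (+-assoc (h zero) _ _))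

∸-split : ∀ x y z → x ∸ y ≤ (x ∸ (y + z)) + z
∸-split x y z = begin
    x ∸ y                ≤⟨ m≤n+m∸n (x ∸ y) z ⟩
    z + (x ∸ y ∸ z)      ≡⟨ +-comm z _ ⟩
    (x ∸ y ∸ z) + z      ≡⟨ cong (_+ z) (∸-+-assoc x y z) ⟩
    (x ∸ (y + z)) + z    ∎
  where open ≤-Reasoning

<ᵇ-true : ∀ {m n} → m < n → (m <ᵇ n) ≡ true
<ᵇ-true m<n = Equivalence.to T-≡ (<⇒<ᵇ m<n)

<ᵇ-sound : ∀ {m n} → (m <ᵇ n) ≡ true → m < n
<ᵇ-sound {m} {n} e = <ᵇ⇒< m n (Equivalence.from T-≡ e)

<ᵇ-false : ∀ {m n} → n ≤ m → (m <ᵇ n) ≡ false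
<ᵇ-false {m} {n} n≤m with m <ᵇ n in e
... | true  = ⊥-elim (<⇒≱ (<ᵇ-sound e) n≤m)
... | false = refl

<ᵇ-false-sound : ∀ {m n} → (m <ᵇ n) ≡ false → n ≤ m
<ᵇ-false-sound e = ≮⇒≥ λ m<n → true≢false (trans (sym (<ᵇ-true m<n)) e)
  where
  true≢false : true ≢ false
  true≢false ()

<ᵇ-cong-⇔ : ∀ {m₁ n₁ m₂ n₂} → (m₁ < n₁ ⇔ m₂ < n₂) → (m₁ <ᵇ n₁) ≡ (m₂ <ᵇ n₂)
<ᵇ-cong-⇔ {m₂ = m₂} {n₂} m₁<n₁⇔m₂<n₂ with m₂ <ᵇ n₂ in e
... | true  = <ᵇ-true (Equivalence.from m₁<n₁⇔m₂<n₂ (<ᵇ-sound e))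
... | false = <ᵇ-false (≮⇒≥ λ m₁<n₁ → <⇒≱ (Equivalence.to m₁<n₁⇔m₂<n₂ m₁<n₁) (<ᵇ-false-sound e))

∧-true : ∀ {x y} → (x ∧ y) ≡ true → x ≡ true × y ≡ true
∧-true {true} {true} _ = refl , refl

ι : Bool → ℕ
ι b = if b then 1 else 0

count : ∀ {N} → (Fin N → Bool) → ℕ
count P = Σ (λ i → ι (P i))

ι-∧ : ∀ x y → ι (x ∧ y) ≤ ι x
ι-∧ true  true  = ≤-refl
ι-∧ true  false = z≤n
ι-∧ false y     = z≤n

ι-mono-<ᵇ : ∀ x {m m′} → m ≤ m′ → ι (x <ᵇ m) ≤ ι (x <ᵇ m′)
ι-mono-<ᵇ x {m} m≤m′ with x <ᵇ m in e
... | false = z≤n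
... | true rewrite <ᵇ-true (<-≤-trans (<ᵇ-sound e) m≤m′) = ≤-refl

count-∧ˡ : ∀ {N} b (P : Fin N → Bool) → ι b * count P ≡ count (λ j → b ∧ P j)
count-∧ˡ     true  P = +-identityʳ _
count-∧ˡ {N} false P = sym (Σ-zero {N} _ (λ _ → refl))

count-≤ : ∀ {N} (P : Fin N → Bool) → count P ≤ N
count-≤ {zero}  P = z≤n
count-≤ {suc N} P with P zero
... | true  = s≤s (count-≤ (P ∘ suc))
... | false = m≤n⇒m≤1+n (count-≤ (P ∘ suc))

count-true : ∀ N → count {N} (λ _ → true) ≡ N
count-true zero    = refl
count-true (suc N) = cong suc (count-true N)

count-full : ∀ {N} (P : Fin N → Bool) → count P ≡ N → ∀ j → P j ≡ true
count-full {suc N} P full j with P zero in P₀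
count-full {suc N} P full zero    | true = P₀
count-full {suc N} P full (suc j) | true = count-full (P ∘ suc) (suc-injective full) j
... | false = ⊥-elim (<-irrefl refl (subst (_≤ N) full (count-≤ (P ∘ suc))))

count-prefix : ∀ N m → m ≤ N → count {N} (λ q → toℕ q <ᵇ m) ≡ m
count-prefix N       zero    _         = Σ-zero {N} _ (λ _ → refl)
count-prefix (suc N) (suc m) (s≤s m≤N) = cong suc (count-prefix N m m≤N)

inWindow : ℕ → ℕ → ℕ → Bool
inWindow m l q = not (q <ᵇ m) ∧ (q <ᵇ m + l)

inWindow-sound : ∀ m l q → inWindow m l q ≡ true → m ≤ q × q < m + l
inWindow-sound m l q e with q <ᵇ m in q≮m
... | false = <ᵇ-false-sound q≮m , <ᵇ-sound e

window-split : ∀ m l q → ι (inWindow m l q) + ι (q <ᵇ m) ≡ ι (q <ᵇ m + l)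
window-split m l q with q <ᵇ m in q<m
... | true rewrite <ᵇ-true {q} {m + l} (<-≤-trans (<ᵇ-sound q<m) (m≤m+n m l)) = refl
... | false = +-identityʳ _

count-window : ∀ N m l → m + l ≤ N → count {N} (λ q → inWindow m l (toℕ q)) ≡ l
count-window N m l m+l≤N = +-cancelʳ-≡ m _ _ (begin
    count (λ (q : Fin N) → inWindow m l (toℕ q)) + m
  ≡⟨ cong (count {N} (λ q → inWindow m l (toℕ q)) +_) (sym (count-prefix N m (≤-trans (m≤m+n m l) m+l≤N))) ⟩
    count (λ (q : Fin N) → inWindow m l (toℕ q)) + count (λ (q : Fin N) → toℕ q <ᵇ m)
  ≡⟨ sym (∑-distrib-+ (λ (q : Fin N) → ι (inWindow m l (toℕ q))) (λ q → ι (toℕ q <ᵇ m))) ⟩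
    Σ (λ (q : Fin N) → ι (inWindow m l (toℕ q)) + ι (toℕ q <ᵇ m))
  ≡⟨ sum-cong-≗ (λ (q : Fin N) → window-split m l (toℕ q)) ⟩
    count (λ (q : Fin N) → toℕ q <ᵇ m + l)
  ≡⟨ count-prefix N (m + l) m+l≤N ⟩
    m + l
  ≡⟨ +-comm m l ⟩
    l + m
  ∎)
  where open ≡-Reasoning

module VertexCost {N : ℕ} (H : Graph N) (τ : Permutation′ N) where

  pos : Fin N → ℕ
  pos x = toℕ (τ ⟨$⟩ˡ x)

  _≺_ : Fin N → Fin N → Bool
  x ≺ y = pos x <ᵇ pos y

  earlier : Fin N → ℕ
  earlier x = count (λ y → (y ≺ x) ∧ adj H y x)

  reindex : (h : Fin N → ℕ) → Σ h ≡ Σ (λ x → h (τ ⟨$⟩ˡ x))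
  reindex h = sum-permute h (flip τ)

  r-earlier : ∀ x → r H τ (τ ⟨$⟩ˡ x) ≡ earlier x
  r-earlier x = begin
      r H τ (τ ⟨$⟩ˡ x)
    ≡⟨ sum-tabulate N id _ ⟩
      count (λ s → (toℕ s <ᵇ pos x) ∧ adj H (τ ⟨$⟩ʳ s) (τ ⟨$⟩ʳ (τ ⟨$⟩ˡ x)))
    ≡⟨ reindex _ ⟩
      count (λ y → (y ≺ x) ∧ adj H (τ ⟨$⟩ʳ (τ ⟨$⟩ˡ y)) (τ ⟨$⟩ʳ (τ ⟨$⟩ˡ x)))
    ≡⟨ sum-cong-≗ (λ y → cong₂ (λ u v → ι ((y ≺ x) ∧ adj H u v)) (inverseʳ τ) (inverseʳ τ)) ⟩
      earlier x
    ∎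
    where open ≡-Reasoning

  cost-by-vertex : (f : ℕ → ℕ) → C f H τ ≡ Σ (λ x → f (earlier x))
  cost-by-vertex f = begin
      C f H τ                          ≡⟨ sum-tabulate N id _ ⟩
      Σ (λ t → f (r H τ t))            ≡⟨ reindex _ ⟩
      Σ (λ x → f (r H τ (τ ⟨$⟩ˡ x)))   ≡⟨ sum-cong-≗ (cong f ∘ r-earlier) ⟩
      Σ (λ x → f (earlier x))          ∎
    where open ≡-Reasoning

module ExtendedCost {n k : ℕ} (G : Graph n) (τ : Permutation′ (n + k)) where

  open VertexCost (extend k G) τ public

  V : Fin n → Fin (n + k)
  V i = i ↑ˡ k

  U : Fin k → Fin (n + k)
  U j = n ↑ʳ j

  adj-VV : ∀ a b → adj' k G (V a) (V b) ≡ adj G a b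
  adj-VV a b rewrite splitAt-↑ˡ n a k | splitAt-↑ˡ n b k = refl

  adj-UV : ∀ a b → adj' k G (U a) (V b) ≡ true
  adj-UV a b rewrite splitAt-↑ʳ n k a | splitAt-↑ˡ n b k = refl

  adj-VU : ∀ a b → adj' k G (V a) (U b) ≡ true
  adj-VU a b rewrite splitAt-↑ˡ n a k | splitAt-↑ʳ n k b = refl

  adj-UU : ∀ a b → adj' k G (U a) (U b) ≡ false
  adj-UU a b rewrite splitAt-↑ʳ n k a | splitAt-↑ʳ n k b = refl

  earlierG : Fin n → ℕ
  earlierG i = count (λ i′ → (V i′ ≺ V i) ∧ adj G i′ i)

  earlierU : Fin n → ℕ
  earlierU i = count (λ j → U j ≺ V i)

  earlierV : Fin k → ℕ
  earlierV j = count (λ i → V i ≺ U j)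

  earlier-V : ∀ i → earlier (V i) ≡ earlierG i + earlierU i
  earlier-V i = trans (Σ-splitAt n k _) (cong₂ _+_
    (sum-cong-≗ λ i′ → cong (λ e → ι ((V i′ ≺ V i) ∧ e)) (adj-VV i′ i))
    (sum-cong-≗ λ j → cong ι (trans (cong ((U j ≺ V i) ∧_) (adj-UV j i)) (∧-identityʳ _))))

  earlier-U : ∀ j → earlier (U j) ≡ earlierV j
  earlier-U j = trans (Σ-splitAt n k _) (trans (cong₂ _+_
    (sum-cong-≗ λ i → cong ι (trans (cong ((V i ≺ U j) ∧_) (adj-VU i j)) (∧-identityʳ _)))
    (Σ-zero _ λ j′ → cong ι (trans (cong ((U j′ ≺ U j) ∧_) (adj-UU j′ j)) (∧-zeroʳ _))))
    (+-identityʳ _))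

  cost-split : (f : ℕ → ℕ) →
    C f (extend k G) τ ≡ Σ (λ i → f (earlierG i + earlierU i)) + Σ (λ j → f (earlierV j))
  cost-split f = trans (cost-by-vertex f) (trans (Σ-splitAt n k _) (cong₂ _+_
    (sum-cong-≗ (cong f ∘ earlier-V)) (sum-cong-≗ (cong f ∘ earlier-U))))

module CanonicalOrder {n k : ℕ} (G : Graph n) (k≤n : k ≤ n) (σ′ : Permutation′ (n + k))
    (U-fills-window : ∀ (p : Fin (n + k)) → k ≤ toℕ p → toℕ p < k + k → ∃ λ (j : Fin k) → σ′ ⟨$⟩ʳ p ≡ n ↑ʳ j)
  where

  open ExtendedCost G σ′ public

  k+k≤N : k + k ≤ n + k
  k+k≤N = +-monoˡ-≤ k k≤n

  isU : Fin (n + k) → Bool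
  isU x with splitAt n x
  ... | inj₁ _ = false
  ... | inj₂ _ = true

  isU-V : ∀ i → isU (V i) ≡ false
  isU-V i rewrite splitAt-↑ˡ n i k = refl

  isU-U : ∀ j → isU (U j) ≡ true
  isU-U j rewrite splitAt-↑ʳ n k j = refl

  V≢U : ∀ i j → V i ≢ U j
  V≢U i j e with trans (sym (splitAt-↑ˡ n i k)) (trans (cong (splitAt n) e) (splitAt-↑ʳ n k j))
  ... | ()

  window-holds-U : ∀ q → ι (inWindow k k (toℕ q)) ≡ ι (isU (σ′ ⟨$⟩ʳ q) ∧ inWindow k k (toℕ q))
  window-holds-U q with inWindow k k (toℕ q) in q∈W
  ... | false = cong ι (sym (∧-zeroʳ _))
  ... | true with U-fills-window q (proj₁ (inWindow-sound k k _ q∈W)) (proj₂ (inWindow-sound k k _ q∈W))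
  ...   | j , σ′q≡Uj rewrite σ′q≡Uj | isU-U j = refl

  -- The k window positions hold k U-vertices, so all U-vertices lie in the window.
  U-window-count : count (λ j → inWindow k k (pos (U j))) ≡ k
  U-window-count = begin
      count (λ j → inWindow k k (pos (U j)))
    ≡⟨ cong₂ _+_ (sym (Σ-zero _ (λ i → cong (λ b → ι (b ∧ inWindow k k (pos (V i)))) (isU-V i))))
                 (sum-cong-≗ (λ j → cong (λ b → ι (b ∧ inWindow k k (pos (U j)))) (sym (isU-U j)))) ⟩
      count (λ i → isU (V i) ∧ inWindow k k (pos (V i))) + count (λ j → isU (U j) ∧ inWindow k k (pos (U j)))
    ≡⟨ sym (Σ-splitAt n k _) ⟩
      count (λ x → isU x ∧ inWindow k k (pos x))
    ≡⟨ sum-cong-≗ (λ x → cong (λ y → ι (isU y ∧ inWindow k k (pos x))) (sym (inverseʳ σ′))) ⟩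
      count (λ x → isU (σ′ ⟨$⟩ʳ (σ′ ⟨$⟩ˡ x)) ∧ inWindow k k (pos x))
    ≡⟨ sym (reindex _) ⟩
      count (λ (q : Fin (n + k)) → isU (σ′ ⟨$⟩ʳ q) ∧ inWindow k k (toℕ q))
    ≡⟨ sym (sum-cong-≗ window-holds-U) ⟩
      count (λ (q : Fin (n + k)) → inWindow k k (toℕ q))
    ≡⟨ count-window (n + k) k k k+k≤N ⟩
      k
    ∎
    where open ≡-Reasoning

  U-in-window : ∀ j → k ≤ pos (U j) × pos (U j) < k + k
  U-in-window j = inWindow-sound k k _ (count-full _ U-window-count j)

  V-off-window : ∀ i → pos (V i) < k ⊎ k + k ≤ pos (V i)
  V-off-window i with k ≤? pos (V i) | pos (V i) <? k + k
  ... | no  k≰p | _        = inj₁ (≰⇒> k≰p)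
  ... | yes _   | no  p≮2k = inj₂ (≮⇒≥ p≮2k)
  ... | yes k≤p | yes p<2k with U-fills-window (σ′ ⟨$⟩ˡ V i) k≤p p<2k
  ...   | j , e = ⊥-elim (V≢U i j (trans (sym (inverseʳ σ′)) e))

  inS : Fin n → Bool
  inS i = pos (V i) <ᵇ k

  |S|≡k : count inS ≡ k
  |S|≡k = begin
      count inS
    ≡⟨ sym (+-identityʳ _) ⟩
      count inS + 0
    ≡⟨ cong (count inS +_) (sym (Σ-zero _ (λ j → cong ι (<ᵇ-false (proj₁ (U-in-window j)))))) ⟩
      count inS + count (λ j → pos (U j) <ᵇ k)
    ≡⟨ sym (Σ-splitAt n k _) ⟩
      count (λ x → pos x <ᵇ k)
    ≡⟨ sym (reindex _) ⟩
      count (λ (q : Fin (n + k)) → toℕ q <ᵇ k)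
    ≡⟨ count-prefix (n + k) k (≤-trans k≤n (m≤m+n n k)) ⟩
      k
    ∎
    where open ≡-Reasoning

  U-after-S : ∀ j → k ≤ earlierV j
  U-after-S j = subst (_≤ earlierV j) |S|≡k (Σ-mono (λ i → ι-mono-<ᵇ (pos (V i)) (proj₁ (U-in-window j))))

  V-after-U : ∀ i → k + k ≤ pos (V i) → earlierU i ≡ k
  V-after-U i 2k≤p = trans (sum-cong-≗ (λ j → cong ι (<ᵇ-true (<-≤-trans (proj₂ (U-in-window j)) 2k≤p))))
                           (count-true k)

  V-cost : ∀ i → k ∸ (earlierG i + earlierU i) ≤ ι (inS i) * (k ∸ earlierG i)
  V-cost i with V-off-window i
  ... | inj₁ p<k rewrite <ᵇ-true p<k =
        ≤-trans (∸-monoʳ-≤ k (m≤m+n (earlierG i) (earlierU i))) (m≤m+n _ 0)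
  ... | inj₂ 2k≤p = ≤-trans (≤-reflexive (m≤n⇒m∸n≡0 k≤g+a)) z≤n
    where
    k≤g+a : k ≤ earlierG i + earlierU i
    k≤g+a = subst (λ a → k ≤ earlierG i + a) (sym (V-after-U i 2k≤p)) (m≤n+m k (earlierG i))

  upper : C (fk k) (extend k G) σ′ ≤ Σ (λ i → ι (inS i) * (k ∸ earlierG i))
  upper = begin
      C (fk k) (extend k G) σ′
    ≡⟨ cost-split (fk k) ⟩
      Σ (λ i → k ∸ (earlierG i + earlierU i)) + Σ (λ j → k ∸ earlierV j)
    ≤⟨ +-mono-≤ (Σ-mono V-cost) (≤-reflexive (Σ-zero _ (λ j → m≤n⇒m∸n≡0 (U-after-S j)))) ⟩
      Σ (λ i → ι (inS i) * (k ∸ earlierG i)) + 0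
    ≡⟨ +-identityʳ _ ⟩
      Σ (λ i → ι (inS i) * (k ∸ earlierG i))
    ∎
    where open ≤-Reasoning

module Comparison {n k : ℕ} (G : Graph n) (k≤n : k ≤ n) (σ σ′ : Permutation′ (n + k))
    (U-fills-window : ∀ (p : Fin (n + k)) → k ≤ toℕ p → toℕ p < k + k → ∃ λ (j : Fin k) → σ′ ⟨$⟩ʳ p ≡ n ↑ʳ j)
    (same-V-order : ∀ (a b : Fin n) → (toℕ (σ′ ⟨$⟩ˡ (a ↑ˡ k)) < toℕ (σ′ ⟨$⟩ˡ (b ↑ˡ k))) ⇔ (toℕ (σ ⟨$⟩ˡ (a ↑ˡ k)) < toℕ (σ ⟨$⟩ˡ (b ↑ˡ k))))
  where

  open ExtendedCost G σ
  module Canon = CanonicalOrder G k≤n σ′ U-fills-window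
  open Canon using (inS; |S|≡k)

  Q : ℕ
  Q = Σ (λ i → ι (inS i) * (k ∸ earlierG i))

  same-≺ : ∀ a b → (V a Canon.≺ V b) ≡ (V a ≺ V b)
  same-≺ a b = <ᵇ-cong-⇔ (same-V-order a b)

  upper : C (fk k) (extend k G) σ′ ≤ Q
  upper = subst (C (fk k) (extend k G) σ′ ≤_)
    (sum-cong-≗ λ i → cong (λ g → ι (inS i) * (k ∸ g))
      (sum-cong-≗ λ i′ → cong (λ b → ι (b ∧ adj G i′ i)) (same-≺ i′ i)))
    Canon.upper

  S-downward : ∀ i i₀ → inS i₀ ≡ true → pos (V i) < pos (V i₀) → inS i ≡ true
  S-downward i i₀ i₀∈S i<i₀ =
    <ᵇ-true (<-trans (<ᵇ-sound {Canon.pos (V i)} (trans (same-≺ i i₀) (<ᵇ-true i<i₀))) (<ᵇ-sound {Canon.pos (V i₀)} {k} i₀∈S))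

  S-after : Fin k → Fin n → Bool
  S-after j i = inS i ∧ (U j ≺ V i)

  S-after-bound : ∀ j → count (S-after j) ≤ k ∸ earlierV j
  S-after-bound j with any? (λ i → S-after j i ≟ᵇ true)
  ... | no none = ≤-trans (≤-reflexive (Σ-zero _ absent)) z≤n
    where
    absent : ∀ i → ι (S-after j i) ≡ 0
    absent i with S-after j i in e
    ... | true  = ⊥-elim (none (i , e))
    ... | false = refl
  ... | yes (i₀ , i₀-after) = m+n≤o⇒m≤o∸n _ (begin
      count (S-after j) + earlierV j
    ≡⟨ sym (∑-distrib-+ (ι ∘ S-after j) (λ i → ι (V i ≺ U j))) ⟩
      Σ (λ i → ι (S-after j i) + ι (V i ≺ U j))
    ≤⟨ Σ-mono disjoint-in-S ⟩
      count inS
    ≡⟨ |S|≡k ⟩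
      k
    ∎)
    where
    open ≤-Reasoning
    member-before-j : ∀ i → pos (V i) < pos (U j) → ι (S-after j i) + 1 ≤ ι (inS i)
    member-before-j i i<j
      rewrite <ᵇ-false (<⇒≤ i<j)
            | S-downward i i₀ (proj₁ (∧-true i₀-after)) (<-trans i<j (<ᵇ-sound {pos (U j)} (proj₂ (∧-true i₀-after))))
      = ≤-refl
    -- Once some member of S follows j, every V-vertex before j is in S.
    disjoint-in-S : ∀ i → ι (S-after j i) + ι (V i ≺ U j) ≤ ι (inS i)
    disjoint-in-S i with V i ≺ U j in i≺j
    ... | false = subst (_≤ ι (inS i)) (sym (+-identityʳ _)) (ι-∧ (inS i) _)
    ... | true = member-before-j i (<ᵇ-sound {pos (V i)} i≺j)

  V-split : ∀ i → ι (inS i) * (k ∸ earlierG i) ≤ (k ∸ (earlierG i + earlierU i)) + ι (inS i) * earlierU i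
  V-split i with inS i
  ... | false = z≤n
  ... | true rewrite +-identityʳ (k ∸ earlierG i) | +-identityʳ (earlierU i) = ∸-split k (earlierG i) (earlierU i)

  S-after-U : Σ (λ i → ι (inS i) * earlierU i) ≡ Σ (λ j → count (S-after j))
  S-after-U = trans (sum-cong-≗ (λ i → count-∧ˡ (inS i) (λ j → U j ≺ V i))) (∑-comm (λ i j → ι (S-after j i)))

  lower : Q ≤ C (fk k) (extend k G) σ
  lower = begin
      Q
    ≤⟨ Σ-mono V-split ⟩
      Σ (λ i → (k ∸ (earlierG i + earlierU i)) + ι (inS i) * earlierU i)
    ≡⟨ ∑-distrib-+ (λ i → k ∸ (earlierG i + earlierU i)) (λ i → ι (inS i) * earlierU i) ⟩
      Σ (λ i → k ∸ (earlierG i + earlierU i)) + Σ (λ i → ι (inS i) * earlierU i)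
    ≡⟨ cong (Σ (λ i → k ∸ (earlierG i + earlierU i)) +_) S-after-U ⟩
      Σ (λ i → k ∸ (earlierG i + earlierU i)) + Σ (λ j → count (S-after j))
    ≤⟨ +-monoʳ-≤ _ (Σ-mono S-after-bound) ⟩
      Σ (λ i → k ∸ (earlierG i + earlierU i)) + Σ (λ j → k ∸ earlierV j)
    ≡⟨ sym (cost-split (fk k)) ⟩
      C (fk k) (extend k G) σ
    ∎
    where open ≤-Reasoning

lemma2 : ∀ {n k : ℕ} (G : Graph n) → 1 ≤ k → k ≤ n
         → (σ σ' : Permutation′ (n + k))
         → (∀ (p : Fin (n + k)) → k ≤ toℕ p → toℕ p < k + k → ∃ λ (j : Fin k) → σ' ⟨$⟩ʳ p ≡ n ↑ʳ j)
         → (∀ (a b : Fin n) → (toℕ (σ' ⟨$⟩ˡ (a ↑ˡ k)) < toℕ (σ' ⟨$⟩ˡ (b ↑ˡ k))) ⇔ (toℕ (σ ⟨$⟩ˡ (a ↑ˡ k)) < toℕ (σ ⟨$⟩ˡ (b ↑ˡ k))))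
         → C (fk k) (extend k G) σ' ≤ C (fk k) (extend k G) σ
lemma2 G _ k≤n σ σ' U-fills-window same-V-order = ≤-trans upper lower
  where open Comparison G k≤n σ σ' U-fills-window same-V-order
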